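{- Let $n\ge1$ and $R_i$ be as in the context. For each $i\in\{ -n-1,\dots,n+1\}$, the relation $R_i$ on $X$ is transitive.
   Context: For $p=(p_1,\dots,p_n)\in\mathbb Q^n$: $(p,q)\in L_1$ iff $p_1<q_1$; for $2\le i\le n$, $(p,q)\in L_i$ iff $(p_1,\dots,p_{i-1})=(q_1,\dots,q_{i-1})$ and $p_i<q_i$. Let $<_n=L_1\cup\dots\cup L_n$. $X=\mathbb Q^n\times\{ -1,1\}$, writing $p^b$ for $(p,b)$, with $p^b\le_X q^d$ iff $p^b=q^d$ or $p<_nq$; $\alpha(p^b)=p^{ -b}$. For $R\subseteq X^2$, $R^c=X^2\setminus R$, $R^\smile$ the converse, $\circ$ relational composition. $U_j=\{(p^b,q^d)\mid b,d\in\{ -1,1\},(p,q)\in L_j\}$. $R_{ -n-1}=\varnothing$; $R_i=\bigcup_{j=1}^{n+1+i}U_j$ for $-n\le i\le-1$; $R_0={\le_X}$; $R_i=(R_{ -i})^{c\smile}\circ\alpha$ for $1\le i\le n+1$. -}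

module Defs where

open import Data.Nat using (ℕ; zero; suc; _+_; _<_)
open import Data.Integer using (ℤ; +_; -[1+_])
open import Data.Rational using (ℚ) renaming (_<_ to _<ℚ_)
open import Data.Fin using (Fin; toℕ)
open import Data.Vec using (Vec; lookup)
open import Data.Sign using (Sign) renaming (opposite to flip)
open import Data.Product using (_×_; _,_; ∃; ∃-syntax; proj₁; proj₂)
open import Data.Sum using (_⊎_)
open import Data.Empty using (⊥)
open import Relation.Nullary using (¬_)
open import Relation.Binary.PropositionalEquality using (_≡_)
open import Level using (0ℓ)
open import Relation.Binary using (Rel)

Pt : ℕ → Set
Pt n = Vec ℚ n

-- L_j with j = suc k (k : Fin n is the 0-based coordinate index):
-- the first k coordinates agree and coordinate k is strictly smaller.
L : ∀ {n} → Fin n → Rel (Pt n) 0ℓ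
L k p q = (∀ (m : Fin _) → toℕ m < toℕ k → lookup p m ≡ lookup q m)
        × (lookup p k <ℚ lookup q k)

_<ₙ_ : ∀ {n} → Rel (Pt n) 0ℓ
p <ₙ q = ∃[ k ] L k p q

-- X = ℚ^n × {-1,1}; the sign is represented by Data.Sign.Sign
X : ℕ → Set
X n = Pt n × Sign

α : ∀ {n} → X n → X n
α (p , b) = (p , flip b)

_≤X_ : ∀ {n} → Rel (X n) 0ℓ
x ≤X y = x ≡ y ⊎ (proj₁ x <ₙ proj₁ y)

_ᶜ : ∀ {A : Set} → Rel A 0ℓ → Rel A 0ℓ
(R ᶜ) x y = ¬ R x y

_⌣ : ∀ {A : Set} → Rel A 0ℓ → Rel A 0ℓ
(R ⌣) x y = R y x

_∘ʳ_ : ∀ {A : Set} → Rel A 0ℓ → Rel A 0ℓ → Rel A 0ℓ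
(R ∘ʳ S) x z = ∃[ y ] (R x y × S y z)

αʳ : ∀ {n} → Rel (X n) 0ℓ
αʳ x y = α x ≡ y

U : ∀ {n} → Fin n → Rel (X n) 0ℓ
U k x y = L k (proj₁ x) (proj₁ y)

-- Rneg n m = R_{-m} for 1 ≤ m ≤ n+1:
--   the union of U_j over 1 ≤ j ≤ n+1-m, i.e. over k = j-1 with k + m < n+1.
-- For m = n+1 this union is empty, matching R_{-n-1} = ∅.
Rneg : (n : ℕ) → ℕ → Rel (X n) 0ℓ
Rneg n m x y = ∃[ k ] ((toℕ k + m < suc n) × U k x y)

R : (n : ℕ) → ℤ → Rel (X n) 0ℓ
R n -[1+ m ]   = Rneg n (suc m)
R n (+ zero)   = _≤X_
R n (+ suc m)  = (((Rneg n (suc m)) ᶜ) ⌣) ∘ʳ αʳ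

{-# OPTIONS --safe #-}
-- Composing L_a with L_b lands in L_min(a,b), so each union of the L_j over an
-- initial segment of indices is transitive; this gives R_{-m} and ≤X.  The same
-- lexicographic comparison shows that such a union is cotransitive: if p L_k r,
-- any q is below r or above p at some index ≤ k.  Since α only changes the sign,
-- which R_{-m} ignores, x R_m z says exactly that z R_{-m} x fails, and the
-- complement of a cotransitive relation is transitive.
module Submission where

open import Defs
open import Data.Nat using (ℕ; _≥_; zero; suc; _≤_; z≤n; s≤s)
open import Data.Nat.Properties using (≤-<-trans; +-monoˡ-≤)
open import Data.Integer using (ℤ; +_; -[1+_]) renaming (_≤_ to _≤ℤ_)
open import Data.Rational using (ℚ) renaming (_<_ to _<ℚ_)
import Data.Rational.Properties as ℚ
open import Data.Fin using (Fin; toℕ; zero; suc)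
open import Data.Vec using (_∷_)
open import Data.Product using (_×_; _,_; ∃-syntax; proj₁)
open import Data.Sum using (_⊎_; inj₁; inj₂; [_,_]′) renaming (map to ⊎-map)
open import Relation.Binary using (Transitive; Cotransitive; tri<; tri≈; tri>)
open import Relation.Binary.PropositionalEquality using (_≡_; refl; sym; trans; subst)
open import Relation.Nullary using (yes; no)

L-zero : ∀ {n} {x y : ℚ} {p q : Pt n} → x <ℚ y → L zero (x ∷ p) (y ∷ q)
L-zero x<y = (λ _ ()) , x<y

L-suc : ∀ {n} {k : Fin n} {x y : ℚ} {p q : Pt n} →
        x ≡ y → L k p q → L (suc k) (x ∷ p) (y ∷ q)
L-suc x≡y (agree , lt) = (λ { zero _ → x≡y ; (suc m) (s≤s m<k) → agree m m<k }) , lt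

L-suc⁻¹ : ∀ {n} {k : Fin n} {x y : ℚ} {p q : Pt n} →
          L (suc k) (x ∷ p) (y ∷ q) → x ≡ y × L k p q
L-suc⁻¹ (agree , lt) = agree zero (s≤s z≤n) , (λ m m<k → agree (suc m) (s≤s m<k)) , lt

L-trans : ∀ {n} {a b : Fin n} {p q r : Pt n} → L a p q → L b q r → L a p r ⊎ L b p r
L-trans {a = zero} {zero} {x ∷ _} {_ ∷ _} {_ ∷ _} (_ , x<y) (_ , y<z) =
  inj₁ (L-zero (ℚ.<-trans x<y y<z))
L-trans {a = zero} {suc _} {x ∷ _} {y ∷ q} {z ∷ r} (_ , x<y) Lqr =
  inj₁ (L-zero (subst (x <ℚ_) (proj₁ (L-suc⁻¹ {x = y} {z} {q} {r} Lqr)) x<y))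
L-trans {a = suc _} {zero} {x ∷ p} {y ∷ q} {z ∷ _} Lpq (_ , y<z) =
  inj₂ (L-zero (subst (_<ℚ z) (sym (proj₁ (L-suc⁻¹ {x = x} {y} {p} {q} Lpq))) y<z))
L-trans {a = suc _} {suc _} {x ∷ p} {y ∷ q} {z ∷ r} Lpq Lqr
  with x≡y , Lpq′ ← L-suc⁻¹ {x = x} {y} {p} {q} Lpq
     | y≡z , Lqr′ ← L-suc⁻¹ {x = y} {z} {q} {r} Lqr =
  ⊎-map (L-suc x≡z) (L-suc x≡z) (L-trans {p = p} {q} {r} Lpq′ Lqr′)
  where x≡z = trans x≡y y≡z

L-cotrans : ∀ {n} {k : Fin n} {p r : Pt n} → L k p r → (q : Pt n) →
            ∃[ l ] (toℕ l ≤ toℕ k × (L l p q ⊎ L l q r))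
L-cotrans {k = zero} {x ∷ _} {_ ∷ _} (_ , x<z) (y ∷ _) with x ℚ.<? y
... | yes x<y = zero , z≤n , inj₁ (L-zero x<y)
... | no x≮y  = zero , z≤n , inj₂ (L-zero (ℚ.≤-<-trans (ℚ.≮⇒≥ x≮y) x<z))
L-cotrans {k = suc _} {x ∷ p} {z ∷ r} Lpr (y ∷ q)
  with x≡z , Lpr′ ← L-suc⁻¹ {x = x} {z} {p} {r} Lpr | ℚ.<-cmp x y
... | tri< x<y _ _ = zero , z≤n , inj₁ (L-zero x<y)
... | tri> _ _ y<x = zero , z≤n , inj₂ (L-zero (subst (y <ℚ_) x≡z y<x))
... | tri≈ _ x≡y _ with l , l≤k , Lpq⊎Lqr ← L-cotrans {p = p} {r} Lpr′ q =
  suc l , s≤s l≤k , ⊎-map (L-suc x≡y) (L-suc (trans (sym x≡y) x≡z)) Lpq⊎Lqr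

<ₙ-trans : ∀ {n} → Transitive (_<ₙ_ {n})
<ₙ-trans {i = p} {q} {r} (a , La) (b , Lb) = [ (a ,_) , (b ,_) ]′ (L-trans {p = p} {q} {r} La Lb)

≤X-trans : ∀ {n} → Transitive (_≤X_ {n})
≤X-trans (inj₁ refl) y≤z        = y≤z
≤X-trans (inj₂ x<y)  (inj₁ refl) = inj₂ x<y
≤X-trans {i = x} {y} {z} (inj₂ x<y) (inj₂ y<z) =
  inj₂ (<ₙ-trans {i = proj₁ x} {proj₁ y} {proj₁ z} x<y y<z)

Rneg-trans : ∀ n m → Transitive (Rneg n m)
Rneg-trans n m {x} {y} {z} (a , a+m≤n , La) (b , b+m≤n , Lb) =
  [ (λ L → a , a+m≤n , L) , (λ L → b , b+m≤n , L) ]′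
    (L-trans {p = proj₁ x} {proj₁ y} {proj₁ z} La Lb)

Rneg-cotrans : ∀ n m → Cotransitive (Rneg n m)
Rneg-cotrans n m {x} {z} (k , k+m≤n , Lk) y
  with l , l≤k , Lxy⊎Lyz ← L-cotrans {p = proj₁ x} {r = proj₁ z} Lk (proj₁ y) =
  ⊎-map (λ L → l , l+m≤n , L) (λ L → l , l+m≤n , L) Lxy⊎Lyz
  where l+m≤n = ≤-<-trans (+-monoˡ-≤ m l≤k) k+m≤n

Rpos-trans : ∀ n m → Transitive (R n (+ suc m))
Rpos-trans n m {x} (y , ¬Syx , refl) (z , ¬Szy , refl) =
  z , (λ Szx → [ ¬Szy , ¬Syx ]′ (Rneg-cotrans n (suc m) {z} {x} Szx y)) , refl

lemma3p6 : (n : ℕ) → n ≥ 1 → (i : ℤ) → -[1+ n ] ≤ℤ i → i ≤ℤ + (suc n) →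
    Transitive (R n i)
lemma3p6 n _ -[1+ m ]  _ _ {x} {y} {z} = Rneg-trans n (suc m) {x} {y} {z}
lemma3p6 n _ (+ zero)  _ _ {x} {y} {z} = ≤X-trans {n} {x} {y} {z}
lemma3p6 n _ (+ suc m) _ _ {x} {y} {z} = Rpos-trans n m {x} {y} {z}
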